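{- Let $\lambda$ be a partition and $\pi$ a reverse plane partition of shape $\lambda$. Let $u\in\mathcal I\cup\mathcal A$ and $v\in\mathcal A\cup\mathcal O$ be cells in the same row such that $\pi(u)<\pi(v)$ and either $i_k\le c(u)<c(v)\le o_{k+1}$ for some $k\in[r]$, or $c(u)<c(v)\le o_1$. Then there exists a candidate $w\in\mathrm{cand}(\pi)$ with $c(w)>c(u)$.
   Context: Cells are pairs $(i,j)\in\mathbb Z^2$; for $u=(i,j)$: $\mathrm n u=(i-1,j)$, $\mathrm e u=(i,j+1)$, $\mathrm s u=(i+1,j)$, $\mathrm w u=(i,j-1)$. A partition $\lambda$ is identified with its Young diagram $\{(i,j):1\le i\le\ell(\lambda),1\le j\le\lambda_i\}$. A reverse plane partition of shape $\lambda$ is $\pi:\lambda\to\mathbb N$ weakly increasing along rows and columns ($\pi(u)\le\pi(\mathrm e u),\pi(\mathrm s u)$), with conventions $\pi(i,j)=0$ if $i\le0$ or $j\le0$ and $\pi(i,j)=\infty$ if $i,j\ge1$, $(i,j)\notin\lambda$. Content $c(i,j)=j-i$. Outer corner: $u\in\lambda$ with $\mathrm e u,\mathrm s u\notin\lambda$; inner corner: $\mathrm e u,\mathrm s u\in\lambda$, $\mathrm e\mathrm s u\notin\lambda$. With $i_1<\dots<i_r$ the contents of inner corners and $o_1<\dots<o_{r+1}$ the contents of outer corners ($o_1<i_1<o_2<\dots<i_r<o_{r+1}$), set $\mathcal I=\{u\in\lambda:c(u)=i_k\text{ some }k\}$, $\mathcal O=\{u\in\lambda:c(u)=o_k\text{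 some }k\}$, $\mathcal A=\{u\in\lambda:c(u)<o_1\text{ or }i_k<c(u)<o_{k+1}\text{ some }k\in[r]\}$, $\mathcal B=\{u\in\lambda:o_k<c(u)<i_k\text{ some }k\in[r]\text{ or }c(u)>o_{r+1}\}$. Candidates: $\mathrm{cand}(\pi)=\{u\in\mathcal O:\pi(u)>\pi(\mathrm w u)\}\cup\{u\in\mathcal A:\pi(u)>\pi(\mathrm w u)\text{ and }\pi(u)>\pi(\mathrm n u)\}$. -}

module Defs where

open import Data.Nat using (ℕ; zero; suc; _≤_; _<_; _>_)
open import Data.Integer as ℤ using (ℤ; +_) renaming (_-_ to _-ℤ_; _<_ to _<ℤ_; _≤_ to _≤ℤ_)
open import Data.Fin using (Fin) renaming (zero to fzero; suc to fsuc)
open import Data.List using (List; []; _∷_)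
open import Data.List.Relation.Unary.All using (All)
open import Data.List.Relation.Unary.Linked using (Linked)
open import Data.Product using (_×_; _,_; proj₁; proj₂; ∃; ∃-syntax)
open import Data.Sum using (_⊎_)
open import Relation.Nullary using (¬_)
open import Relation.Binary.PropositionalEquality using (_≡_)

_⇔'_ : Set → Set → Set
A ⇔' B = (A → B) × (B → A)

IsPartition : List ℕ → Set
IsPartition λ' = Linked (λ a b → b ≤ a) λ' × All (λ a → 0 < a) λ'

-- Row length λ_i, rows indexed from 1 (λ_i = 0 for i = 0 or i > ℓ(λ)).
rowLen : List ℕ → ℕ → ℕ
rowLen _ zero = 0
rowLen [] (suc _) = 0
rowLen (x ∷ _) (suc zero) = x
rowLen (_ ∷ xs) (suc (suc i)) = rowLen xs (suc i)

Cell : Set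
Cell = ℕ × ℕ

_∈λ_ : Cell → List ℕ → Set
(i , j) ∈λ λ' = 1 ≤ i × 1 ≤ j × j ≤ rowLen λ' i

-- neighbours (only n and w can leave ℕ²; we only apply them to cells of λ,
-- where i,j ≥ 1, so truncated predecessor is exact)
nC eC sC wC : Cell → Cell
nC (i , j) = (Data.Nat._∸_ i 1 , j)
eC (i , j) = (i , suc j)
sC (i , j) = (suc i , j)
wC (i , j) = (i , Data.Nat._∸_ j 1)

content : Cell → ℤ
content (i , j) = + j -ℤ + i

-- Reverse plane partition of shape λ: values on cells of λ, weakly
-- increasing along rows and columns (values off λ are irrelevant).
IsRPP : List ℕ → (Cell → ℕ) → Set
IsRPP λ' π = ∀ u → u ∈λ λ' →
  (eC u ∈λ λ' → π u ≤ π (eC u)) × (sC u ∈λ λ' → π u ≤ π (sC u))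

πext : (Cell → ℕ) → Cell → ℕ
πext π (zero , _) = 0
πext π (suc _ , zero) = 0
πext π (suc i , suc j) = π (suc i , suc j)

OuterCorner : List ℕ → Cell → Set
OuterCorner λ' u = u ∈λ λ' × ¬ (eC u ∈λ λ') × ¬ (sC u ∈λ λ')

InnerCorner : List ℕ → Cell → Set
InnerCorner λ' u = u ∈λ λ' × eC u ∈λ λ' × sC u ∈λ λ' × ¬ (eC (sC u) ∈λ λ')

StrictlyIncreasing : ∀ {n} → (Fin n → ℤ) → Set
StrictlyIncreasing {n} f = ∀ (a b : Fin n) → Data.Fin._<_ a b → f a <ℤ f b

-- Corner data: r, the inner-corner contents i₁<…<i_r (0-indexed: ic k = i_{k+1})
-- and outer-corner contents o₁<…<o_{r+1} (oc k = o_{k+1}), each enumerating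
-- exactly the set of contents of inner / outer corners.
record CornerData (λ' : List ℕ) : Set where
  field
    r  : ℕ
    ic : Fin r → ℤ
    oc : Fin (suc r) → ℤ
    ic-incr : StrictlyIncreasing ic
    oc-incr : StrictlyIncreasing oc
    ic-enum : ∀ z → (∃[ k ] ic k ≡ z) ⇔' (∃[ u ] InnerCorner λ' u × content u ≡ z)
    oc-enum : ∀ z → (∃[ k ] oc k ≡ z) ⇔' (∃[ u ] OuterCorner λ' u × content u ≡ z)

module _ {λ' : List ℕ} (cd : CornerData λ') where
  open CornerData cd

  InI : Cell → Set
  InI u = u ∈λ λ' × ∃[ k ] content u ≡ ic k

  InO : Cell → Set
  InO u = u ∈λ λ' × ∃[ k ] content u ≡ oc k

  InA : Cell → Set
  InA u = u ∈λ λ' × (content u <ℤ oc fzero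
            ⊎ ∃[ k ] (ic k <ℤ content u × content u <ℤ oc (fsuc k)))

  InB : Cell → Set
  InB u = u ∈λ λ' × (∃[ k ] (oc (Data.Fin.inject₁ k) <ℤ content u × content u <ℤ ic k)
            ⊎ oc (Data.Fin.fromℕ r) <ℤ content u)

  Cand : (Cell → ℕ) → Cell → Set
  Cand π u = (InO u × πext π u > πext π (wC u))
           ⊎ (InA u × πext π u > πext π (wC u) × πext π u > πext π (nC u))

-- Since π(u) < π(v), the row of u and v has an ascent π(w x) < π(x) at some cell x with
-- c(u) < c(x) ≤ c(v). The bounds on c(u), c(v) put every content of (c(u), c(v)) in the
-- range of 𝓐, so only c(v) itself can be an outer content. Hence x is a candidate if
-- it lies in 𝓞, or if π(n x) < π(x). Otherwise column monotonicity gives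
-- π(w n x) ≤ π(w x) < π(x) ≤ π(n x): the ascent moves one row up to n x, whose content is
-- one larger and still at most c(v). This cannot go on past row 1, where π(n x) = 0.
module Submission where

open import Defs
open import Data.Nat using (ℕ)
open import Data.Integer using () renaming (_<_ to _<ℤ_; _≤_ to _≤ℤ_)
open import Data.Fin using () renaming (zero to fzero; suc to fsuc)
open import Data.Fin using (Fin)
open import Data.List using (List)
open import Data.Product using (_×_; _,_; proj₁; ∃-syntax)
open import Data.Sum using (_⊎_)
open import Relation.Binary.PropositionalEquality using (_≡_)

open import Data.Nat using (zero; suc; z≤n; s≤s; _≤_; _<_; _<?_)
open import Data.Nat.Properties
  using (≤-refl; ≤-trans; ≤-<-trans; <-≤-trans; ≤-pred; n≤1+n; m≤n⇒m≤1+n; m≤n⇒m<n∨m≡n; ≮⇒≥; ≰⇒>)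
open import Data.Integer as ℤ using (ℤ; +_; +<+; +≤+; 1ℤ) renaming (_-_ to _-ℤ_)
open import Data.Integer.Properties as ℤ
  using (≤∧≢⇒<; i<j⇒suc[i]≤j; suc[i]≤j⇒i<j; <⇒≱)
open import Data.Integer.Tactic.RingSolver using (solve-∀)
open import Data.List.Relation.Unary.Linked using (Linked; []; [-]; _∷_)
open import Data.Product using (proj₂)
open import Data.Sum using (inj₁; inj₂; [_,_])
open import Relation.Nullary using (yes; no)
open import Relation.Nullary.Negation using (contradiction)
open import Relation.Binary.PropositionalEquality using (refl; sym; subst)

content-north : ∀ i j → content (i , j) ≡ ℤ.suc (content (suc i , j))
content-north i j = shift (+ i) (+ j)
  where
  shift : ∀ x y → y -ℤ x ≡ 1ℤ ℤ.+ (y -ℤ (1ℤ ℤ.+ x))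
  shift = solve-∀

content-south<content : ∀ i j → content (suc i , j) <ℤ content (i , j)
content-south<content i j = suc[i]≤j⇒i<j (ℤ.≤-reflexive (sym (content-north i j)))

content-monoʳ-< : ∀ i {a b} → a < b → content (i , a) <ℤ content (i , b)
content-monoʳ-< i a<b = ℤ.+-monoˡ-< (ℤ.- (+ i)) (+<+ a<b)

content-monoʳ-≤ : ∀ i {a b} → a ≤ b → content (i , a) ≤ℤ content (i , b)
content-monoʳ-≤ i a≤b = ℤ.+-monoˡ-≤ (ℤ.- (+ i)) (+≤+ a≤b)

content-cancelʳ-< : ∀ i {a b} → content (i , a) <ℤ content (i , b) → a < b
content-cancelʳ-< i c<c = ≰⇒> (λ b≤a → <⇒≱ c<c (content-monoʳ-≤ i b≤a))

rowLen-antitone : ∀ {λ'} → Linked (λ a b → b ≤ a) λ' → ∀ i → rowLen λ' (suc (suc i)) ≤ rowLen λ' (suc i)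
rowLen-antitone [] i = z≤n
rowLen-antitone [-] i = z≤n
rowLen-antitone (b≤a ∷ _) zero = b≤a
rowLen-antitone (_ ∷ linked) (suc i) = rowLen-antitone linked i

∈λ-north : ∀ {λ' i j} → IsPartition λ' → (suc (suc i) , j) ∈λ λ' → (suc i , j) ∈λ λ'
∈λ-north part (_ , 1≤j , j≤) = s≤s z≤n , 1≤j , ≤-trans j≤ (rowLen-antitone (proj₁ part) _)

∈λ-west : ∀ {λ' i j} → (i , suc (suc j)) ∈λ λ' → (i , suc j) ∈λ λ'
∈λ-west (1≤i , _ , j≤) = 1≤i , s≤s z≤n , ≤-trans (n≤1+n _) j≤

last-ascent : ∀ (f : ℕ → ℕ) {a b} → a < b → f a < f b →
  ∃[ j ] (a ≤ j × suc j ≤ b × f j < f (suc j))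
last-ascent f {a} {suc b} a<1+b fa<fb with f b <? f (suc b)
... | yes ascent = b , ≤-pred a<1+b , ≤-refl , ascent
... | no no-ascent with m≤n⇒m<n∨m≡n (≤-pred a<1+b)
...   | inj₂ refl = contradiction fa<fb no-ascent
...   | inj₁ a<b with last-ascent f a<b (<-≤-trans fa<fb (≮⇒≥ no-ascent))
...     | j , a≤j , 1+j≤b , ascent = j , a≤j , m≤n⇒m≤1+n 1+j≤b , ascent

module _ {λ' : List ℕ} (cd : CornerData λ') where
  open CornerData cd

  InARange : ℤ → Set
  InARange z = z <ℤ oc fzero ⊎ ∃[ k ] (ic k <ℤ z × z <ℤ oc (fsuc k))

  Window : ℤ → Fin (suc r) → Set
  Window c₀ t = ∀ z → c₀ <ℤ z → z <ℤ oc t → InARange z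

  window-around : ∀ {c₀ c} →
    (∃[ k ] (ic k ≤ℤ c₀ × c₀ <ℤ c × c ≤ℤ oc (fsuc k))) ⊎ (c₀ <ℤ c × c ≤ℤ oc fzero) →
    ∃[ t ] (Window c₀ t × c₀ <ℤ c × c ≤ℤ oc t)
  window-around (inj₁ (k , iₖ≤c₀ , c₀<c , c≤oₖ₊₁)) =
    fsuc k , (λ z c₀<z z<oₖ₊₁ → inj₂ (k , ℤ.≤-<-trans iₖ≤c₀ c₀<z , z<oₖ₊₁)) , c₀<c , c≤oₖ₊₁
  window-around (inj₂ (c₀<c , c≤o₁)) = fzero , (λ _ _ → inj₁) , c₀<c , c≤o₁

module _ {λ' : List ℕ} (part : IsPartition λ') (cd : CornerData λ')
         (π : Cell → ℕ) (rpp : IsRPP λ' π) where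
  open CornerData cd

  CandidateAbove : ℤ → Set
  CandidateAbove c₀ = ∃[ w ] (Cand cd π w × c₀ <ℤ content w)

  ascent⇒candidate : ∀ {c₀ t} → Window cd c₀ t → ∀ i j → let x = (suc i , suc (suc j)) in
    x ∈λ λ' → π (wC x) < π x → c₀ <ℤ content x → content x ≤ℤ oc t → CandidateAbove c₀
  ascent⇒candidate {c₀} {t} window i j x∈λ west<x c₀<x x≤oₜ
    with content (suc i , suc (suc j)) ℤ.≟ oc t
  ... | yes x≡oₜ = _ , inj₁ ((x∈λ , t , x≡oₜ) , west<x) , c₀<x
  ... | no x≢oₜ with πext π (i , suc (suc j)) <? π (suc i , suc (suc j))
  ...   | yes north<x = _ , inj₂ ((x∈λ , window _ c₀<x (≤∧≢⇒< x≤oₜ x≢oₜ)) , west<x , north<x) , c₀<x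
  ascent⇒candidate window zero j x∈λ west<x c₀<x x≤oₜ | no _ | no north≮x =
    contradiction (≤-<-trans z≤n west<x) north≮x
  ascent⇒candidate {c₀} {t} window (suc i) j x∈λ west<x c₀<x x≤oₜ | no x≢oₜ | no north≮x =
    ascent⇒candidate window i j north∈λ west<north c₀<north north≤oₜ
    where
    north∈λ : (suc i , suc (suc j)) ∈λ λ'
    north∈λ = ∈λ-north part x∈λ
    west<north : π (suc i , suc j) < π (suc i , suc (suc j))
    west<north = ≤-<-trans (proj₂ (rpp _ (∈λ-west {λ'} north∈λ)) (∈λ-west {λ'} x∈λ))
                           (<-≤-trans west<x (≮⇒≥ north≮x))
    c₀<north : c₀ <ℤ content (suc i , suc (suc j))
    c₀<north = ℤ.<-trans c₀<x (content-south<content (suc i) (suc (suc j)))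
    north≤oₜ : content (suc i , suc (suc j)) ≤ℤ oc t
    north≤oₜ = subst (_≤ℤ oc t) (sym (content-north (suc i) (suc (suc j))))
                     (i<j⇒suc[i]≤j (≤∧≢⇒< x≤oₜ x≢oₜ))

  candidate-in-row : ∀ {t} i {a b} → let u = (i , a) ; v = (i , b) in
    Window cd (content u) t → u ∈λ λ' → v ∈λ λ' → π u < π v →
    content u <ℤ content v → content v ≤ℤ oc t → CandidateAbove (content u)
  candidate-in-row (suc i) {a} {b} window (_ , 1≤a , _) (_ , _ , b≤) πu<πv u<v v≤oₜ
    with last-ascent (λ j → π (suc i , j)) (content-cancelʳ-< (suc i) u<v) πu<πv
  ... | suc j , a≤j , 2+j≤b , ascent =
    ascent⇒candidate window i j (s≤s z≤n , s≤s z≤n , ≤-trans 2+j≤b b≤) ascent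
      (content-monoʳ-< (suc i) (s≤s a≤j)) (ℤ.≤-trans (content-monoʳ-≤ (suc i) 2+j≤b) v≤oₜ)
  ... | zero , a≤0 , _ = contradiction (≤-trans 1≤a a≤0) λ ()

mainTheorem2 : (λ' : List ℕ) → IsPartition λ' → (cd : CornerData λ') →
    (π : Cell → ℕ) → IsRPP λ' π →
    (u v : Cell) → (InI cd u ⊎ InA cd u) → (InA cd v ⊎ InO cd v) →
    proj₁ u ≡ proj₁ v → π u Data.Nat.< π v →
    ((∃[ k ] (CornerData.ic cd k ≤ℤ content u × content u <ℤ content v
               × content v ≤ℤ CornerData.oc cd (fsuc k)))
     ⊎ (content u <ℤ content v × content v ≤ℤ CornerData.oc cd fzero)) →
    ∃[ w ] (Cand cd π w × content u <ℤ content w)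
mainTheorem2 λ' part cd π rpp (i , a) (.i , b) u∈I∪A v∈A∪O refl πu<πv bounds =
  let t , window , u<v , v≤oₜ = window-around cd bounds
  in candidate-in-row part cd π rpp i window
       ([ proj₁ , proj₁ ] u∈I∪A) ([ proj₁ , proj₁ ] v∈A∪O) πu<πv u<v v≤oₜ
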